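{- For all agents $a,b\in A$ and every formula $\varphi\in\mathcal L_\forall$, the formula $\exists_a\exists_b\varphi\leftrightarrow\exists_b\exists_a\varphi$ is valid.
   Context: Fix a finite set $A$ of agents and a set $P$ of propositional variables. Models $M=(S,R,V)$ with $R_a\subseteq S\times S$ and $V:P\to\mathcal P(S)$; $sR_a=\{t\mid(s,t)\in R_a\}$. $M_s\succeq_a M'_{s'}$ iff there is a nonempty $\mathfrak F\subseteq S\times S'$ containing $(s,s')$ such that for all $(u,u')\in\mathfrak F$: $u\in V(p)$ iff $u'\in V'(p)$ for all $p$; for every $c\in A$ and $v'\in u'R'_c$ there is $v\in uR_c$ with $(v,v')\in\mathfrak F$; for every $c\in A\setminus\{a\}$ and $v\in uR_c$ there is $v'\in u'R'_c$ with $(v,v')\in\mathfrak F$. $\mathcal L_\forall$: $\varphi::=p\mid\neg\varphi\mid(\varphi\wedge\varphi)\mid\Box_a\varphi\mid\forall_a\varphi$, with standard semantics for $\Box_a$ and $M_s\models\forall_a\varphi$ iff $M'_{s'}\models\varphi$ for every $M'_{s'}$ with $M_s\succeq_a M'_{s'}$; $\exists_a\varphi:=\neg\forall_a\neg\varphi$. Valid means true at every pointed model. -}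

module Defs where

open import Data.Nat using (ℕ)
open import Level using (Lift; suc; zero)
open import Data.Fin using (Fin)
open import Data.Product using (Σ; _×_; _,_)
open import Relation.Nullary using (¬_)
open import Relation.Binary.PropositionalEquality using (_≡_)
open import Function.Bundles using (_⇔_)

-- Agents: the finite set A is Fin n.  Propositional variables: an arbitrary type P.

record Model (n : ℕ) (P : Set) : Set₁ where
  field
    S : Set
    R : Fin n → S → S → Set     -- R a s t  :  (s,t) ∈ R_a, i.e. t ∈ s R_a
    V : P → S → Set

open Model public

record Pointed (n : ℕ) (P : Set) : Set₁ where
  constructor _,,_
  field
    model : Model n P
    point : S model

open Pointed public

-- The a-refinement relation  M_s ⪰_a M'_{s'}:
-- a relation 𝔉 ⊆ S × S' containing (s,s') (hence nonempty) satisfying atoms,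
-- back for all agents, and forth for all agents other than a.
record IsRefinement {n : ℕ} {P : Set} (a : Fin n) (M M' : Model n P)
                    (𝔉 : S M → S M' → Set) : Set where
  field
    atoms : ∀ {u u'} → 𝔉 u u' → ∀ p → (V M p u ⇔ V M' p u')
    back  : ∀ {u u'} → 𝔉 u u' → ∀ c v' → R M' c u' v' →
              Σ (S M) λ v → R M c u v × 𝔉 v v'
    forth : ∀ {u u'} → 𝔉 u u' → ∀ c → ¬ (c ≡ a) → ∀ v → R M c u v →
              Σ (S M') λ v' → R M' c u' v' × 𝔉 v v'

_⪰[_]_ : {n : ℕ} {P : Set} → Pointed n P → Fin n → Pointed n P → Set₁
(M ,, s) ⪰[ a ] (M' ,, s') =
  Σ (S M → S M' → Set) λ 𝔉 → 𝔉 s s' × IsRefinement a M M' 𝔉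

data Form (n : ℕ) (P : Set) : Set where
  var  : P → Form n P
  ¬'_  : Form n P → Form n P
  _∧'_ : Form n P → Form n P → Form n P
  □    : Fin n → Form n P → Form n P
  ∀'   : Fin n → Form n P → Form n P

∃' : {n : ℕ} {P : Set} → Fin n → Form n P → Form n P
∃' a φ = ¬' (∀' a (¬' φ))

_∨'_ : {n : ℕ} {P : Set} → Form n P → Form n P → Form n P
φ ∨' ψ = ¬' ((¬' φ) ∧' (¬' ψ))

_→'_ : {n : ℕ} {P : Set} → Form n P → Form n P → Form n P
φ →' ψ = ¬' (φ ∧' (¬' ψ))

_↔'_ : {n : ℕ} {P : Set} → Form n P → Form n P → Form n P
φ ↔' ψ = (φ →' ψ) ∧' (ψ →' φ)

-- Satisfaction (classical reading of ¬ as type-theoretic negation).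
_⊨_ : {n : ℕ} {P : Set} → Pointed n P → Form n P → Set₁
(M ,, s) ⊨ var p    = Lift (suc zero) (V M p s)
(M ,, s) ⊨ (¬' φ)   = ¬ ((M ,, s) ⊨ φ)
(M ,, s) ⊨ (φ ∧' ψ) = ((M ,, s) ⊨ φ) × ((M ,, s) ⊨ ψ)
(M ,, s) ⊨ □ a φ    = ∀ t → R M a s t → (M ,, t) ⊨ φ
(M ,, s) ⊨ ∀' a φ   = ∀ N → (M ,, s) ⪰[ a ] N → N ⊨ φ

Valid : {n : ℕ} {P : Set} → Form n P → Set₁
Valid {n} {P} φ = (M : Pointed n P) → M ⊨ φ

module Submission where

open import Defs
open import Data.Nat using (ℕ)
open import Data.Fin using (Fin; _≟_)
open import Data.Product using (Σ; _×_; _,_)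
open import Data.Sum using (_⊎_; inj₁; inj₂)
open import Data.Empty using (⊥; ⊥-elim)
open import Relation.Nullary using (yes; no)
open import Relation.Binary.PropositionalEquality using (_≡_; refl)
open import Function.Construct.Identity using (⇔-id)
open import Function.Construct.Composition using (_⇔-∘_)

-- Refinements for different agents commute: from M ⪰_a N ⪰_b K we build a
-- model L with M ⪰_b L ⪰_a K.  The states of L are the states of M together
-- with the triples (u, x, k) linked by the two refinement relations, a triple
-- moving as u does in M and as k does in K.  Then M embeds into L (a
-- b-refinement) and L projects onto K (an a-refinement), so ∃_a ∃_b φ entails
-- ∃_b ∃_a φ.

module RefinementsCommute {n : ℕ} {P : Set} (a b : Fin n) {M N K : Model n P}
  {𝔉 : S M → S N → Set} (M⪰N : IsRefinement a M N 𝔉)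
  {𝔊 : S N → S K → Set} (N⪰K : IsRefinement b N K 𝔊) where

  open IsRefinement

  record Trace : Set where
    constructor trace
    field
      src     : S M
      mid     : S N
      tgt     : S K
      src~mid : 𝔉 src mid
      mid~tgt : 𝔊 mid tgt

  open Trace

  -- The a-steps from a trace into the copy of M let the embedding match M's
  -- a-steps, which 𝔉 need not do; the projection owes no forth along a.
  Step : Fin n → S M ⊎ Trace → S M ⊎ Trace → Set
  Step c (inj₁ u) (inj₁ v) = R M c u v
  Step c (inj₁ u) (inj₂ t) = ⊥
  Step c (inj₂ t) (inj₁ v) = (c ≡ a) × R M c (src t) v
  Step c (inj₂ t) (inj₂ t') = R M c (src t) (src t') × R K c (tgt t) (tgt t')

  Val : P → S M ⊎ Trace → Set
  Val p (inj₁ u) = V M p u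
  Val p (inj₂ t) = V M p (src t)

  Interleaved : Model n P
  Interleaved = record { S = S M ⊎ Trace ; R = Step ; V = Val }

  Embed : S M → S M ⊎ Trace → Set
  Embed u (inj₁ v) = u ≡ v
  Embed u (inj₂ t) = u ≡ src t

  Project : S M ⊎ Trace → S K → Set
  Project (inj₁ _) _ = ⊥
  Project (inj₂ t) k = tgt t ≡ k

  embed-isRefinement : IsRefinement b M Interleaved Embed
  embed-isRefinement .atoms {u' = inj₁ _} refl p = ⇔-id _
  embed-isRefinement .atoms {u' = inj₂ _} refl p = ⇔-id _
  embed-isRefinement .back {u' = inj₁ _} refl c (inj₁ v) uRv = v , uRv , refl
  embed-isRefinement .back {u' = inj₂ _} refl c (inj₁ v) (_ , uRv) = v , uRv , refl
  embed-isRefinement .back {u' = inj₂ _} refl c (inj₂ t') (uRv , _) = src t' , uRv , refl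
  embed-isRefinement .forth {u' = inj₁ _} refl c _ v uRv = inj₁ v , uRv , refl
  embed-isRefinement .forth {u' = inj₂ t} refl c c≢b v uRv with c ≟ a
  ... | yes c≡a = inj₁ v , (c≡a , uRv) , refl
  ... | no c≢a with forth M⪰N (src~mid t) c c≢a v uRv
  ... | y , xRy , v~y with forth N⪰K (mid~tgt t) c c≢b y xRy
  ... | l , kRl , y~l = inj₂ (trace v y l v~y y~l) , (uRv , kRl) , refl

  project-isRefinement : IsRefinement a Interleaved K Project
  project-isRefinement .atoms {inj₂ t} refl p =
    atoms N⪰K (mid~tgt t) p ⇔-∘ atoms M⪰N (src~mid t) p
  project-isRefinement .back {inj₂ t} refl c l kRl with back N⪰K (mid~tgt t) c l kRl
  ... | y , xRy , y~l with back M⪰N (src~mid t) c y xRy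
  ... | v , uRv , v~y = inj₂ (trace v y l v~y y~l) , (uRv , kRl) , refl
  project-isRefinement .forth {inj₂ t} refl c c≢a (inj₁ _) (c≡a , _) = ⊥-elim (c≢a c≡a)
  project-isRefinement .forth {inj₂ t} refl c _ (inj₂ t') (_ , kRl) = tgt t' , kRl , refl

⪰-commute : {n : ℕ} {P : Set} (a b : Fin n) (M N K : Pointed n P) →
            M ⪰[ a ] N → N ⪰[ b ] K →
            Σ (Pointed n P) λ L → M ⪰[ b ] L × L ⪰[ a ] K
⪰-commute a b (M ,, s) (N ,, x) (K ,, k) (𝔉 , s~x , M⪰N) (𝔊 , x~k , N⪰K) =
  (Interleaved ,, inj₂ (trace s x k s~x x~k)) ,
  (Embed , refl , embed-isRefinement) ,
  (Project , refl , project-isRefinement)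
  where open RefinementsCommute a b M⪰N N⪰K

∃∃-commute : {n : ℕ} {P : Set} (a b : Fin n) (φ : Form n P) (M : Pointed n P) →
             M ⊨ ∃' a (∃' b φ) → M ⊨ ∃' b (∃' a φ)
∃∃-commute a b φ M M⊨∃a∃bφ no-b-refinement =
  M⊨∃a∃bφ λ N M⪰N N⊨∃bφ → N⊨∃bφ λ K N⪰K K⊨φ →
    let (L , M⪰L , L⪰K) = ⪰-commute a b M N K M⪰N N⪰K
    in no-b-refinement L M⪰L λ no-a-refinement → no-a-refinement K L⪰K K⊨φ

→'-intro : {n : ℕ} {P : Set} (φ ψ : Form n P) (M : Pointed n P) →
           (M ⊨ φ → M ⊨ ψ) → M ⊨ (φ →' ψ)
→'-intro φ ψ M φ⇒ψ (M⊨φ , M⊭ψ) = M⊭ψ (φ⇒ψ M⊨φ)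

proposition7 : {n : ℕ} {P : Set} (a b : Fin n) (φ : Form n P) →
    Valid (∃' a (∃' b φ) ↔' ∃' b (∃' a φ))
proposition7 a b φ M =
  →'-intro (∃' a (∃' b φ)) (∃' b (∃' a φ)) M (∃∃-commute a b φ M) ,
  →'-intro (∃' b (∃' a φ)) (∃' a (∃' b φ)) M (∃∃-commute b a φ M)
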